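{- There exists an infinite family of strings $w$, with lengths $n=|w|$ unbounded over the family, such that $v(w^R)-v(w)=\frac{n+2}{6}-1$ for every $w$ in the family (in particular $\Theta(n)$).
   Context: Strings are over a finite totally ordered alphabet (which may depend on the string), compared lexicographically. For $w=w[1]\cdots w[n]$, $w^R=w[n]\cdots w[1]$. The lex-parse of $w$ is the factorization $w=x_1\cdots x_v$ defined left to right: if phrase $x_j$ starts at position $i=1+\sum_{t<j}|x_t|$, its length is $\max\{1,\ell\}$, where $\ell$ is the length of the longest common prefix of $w[i\ldots n]$ with the suffix of $w$ immediately preceding it in lexicographic order among all suffixes of $w$ ($\ell=0$ if $w[i\ldots n]$ is the smallest suffix). $v(w)$ is the number of phrases. -}

module Defs where

open import Data.Nat using (ℕ; zero; suc; _+_; _⊔_; _<ᵇ_)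
open import Data.Fin using (Fin; _<?_; _≟_)
open import Data.List using (List; []; _∷_; length; drop; take; upTo; map)
open import Data.Maybe using (Maybe; just; nothing; maybe)
open import Data.Bool using (Bool; true; false; if_then_else_)
open import Relation.Nullary using (yes; no)

module _ {σ : ℕ} where

  lexLt : List (Fin σ) → List (Fin σ) → Bool
  lexLt []      []      = false
  lexLt []      (_ ∷ _) = true
  lexLt (_ ∷ _) []      = false
  lexLt (a ∷ x) (b ∷ y) with a <? b
  ... | yes _ = true
  ... | no _ with a ≟ b
  ...   | yes _ = lexLt x y
  ...   | no _  = false

  lcp : List (Fin σ) → List (Fin σ) → ℕ
  lcp (a ∷ x) (b ∷ y) with a ≟ b
  ... | yes _ = suc (lcp x y)
  ... | no _  = 0
  lcp _ _ = 0

  suffixes : List (Fin σ) → List (List (Fin σ))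
  suffixes w = map (λ i → drop i w) (upTo (length w))

  predIn : List (List (Fin σ)) → List (Fin σ) → Maybe (List (Fin σ))
  predIn []       s = nothing
  predIn (t ∷ ts) s with predIn ts s
  ... | nothing = if lexLt t s then just t else nothing
  ... | just b  = if lexLt t s then (if lexLt b t then just t else just b) else just b

  predSuffix : List (Fin σ) → List (Fin σ) → Maybe (List (Fin σ))
  predSuffix w s = predIn (suffixes w) s

  phraseLen : List (Fin σ) → ℕ → ℕ
  phraseLen w i = 1 ⊔ maybe (lcp (drop i w)) 0 (predSuffix w (drop i w))

  -- lex-parse from position i, with fuel (every phrase has length ≥ 1)
  parseFrom : ℕ → List (Fin σ) → ℕ → List (List (Fin σ))
  parseFrom zero    w i = []
  parseFrom (suc f) w i =
    if i <ᵇ length w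
    then take (phraseLen w i) (drop i w) ∷ parseFrom f w (i + phraseLen w i)
    else []

  lexParse : List (Fin σ) → List (List (Fin σ))
  lexParse w = parseFrom (length w) w 0

  v : List (Fin σ) → ℕ
  v w = length (lexParse w)

{-# OPTIONS --safe #-}
-- If every letter of x lies below a threshold and every letter of y above it
-- (or vice versa), a suffix of x ++ y starting in x shares no prefix with one starting in y, and
-- two suffixes starting in x already differ inside x; how they compare depends on y only through
-- the side of the letters of x on which y lies. So the lex-parse of x ++ y is a parse of x,
-- unchanged when y is replaced by any y′ on the same side, followed by the lex-parse of y.
-- Raising all letters does not change the parse, hence peeling off the first block costs
-- 4 phrases in wₖ (take y′ to be the letter 3) and 5 in its reverse (take y′ empty):
-- v(wₖ) = 2 + 4k and v(wₖᴿ) = 2 + 5k.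
module Submission where

open import Defs
open import Data.Bool using (true; false; if_then_else_; not; T)
open import Data.Empty using (⊥-elim)
open import Data.Fin as Fin using (Fin; zero; suc; toℕ; _↑ʳ_)
import Data.Fin.Properties as Finₚ
open import Data.List using (List; []; _∷_; [_]; length; reverse; _++_; map; drop; upTo; applyUpTo)
open import Data.List.Properties
  using (length-map; length-++; length-drop; drop-map; reverse-++; reverse-map; map-upTo; ++-identityʳ)
open import Data.List.Relation.Unary.All as All using (All; []; _∷_)
open import Data.List.Relation.Unary.All.Properties using (drop⁺; map⁺)
open import Data.Maybe using (just; nothing; maybe)
import Data.Maybe.Relation.Unary.All as Maybe
open import Data.Nat using (ℕ; zero; suc; _+_; _*_; _∸_; _⊔_; _≤_; _<_; z≤n; s≤s; z<s; s<s; _<ᵇ_)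
open import Data.Nat.Properties
open import Algebra.Properties.CommutativeSemigroup +-commutativeSemigroup using (xy∙z≈xz∙y)
open import Data.Nat.Tactic.RingSolver using (solve-∀)
open import Data.Product using (Σ; _×_; _,_; proj₁; proj₂; ∃-syntax)
open import Data.Sum using (_⊎_; inj₁; inj₂)
open import Data.Unit using (tt)
open import Function using (_∘_)
open import Level using (0ℓ)
open import Relation.Binary using (tri<; tri≈; tri>)
open import Relation.Binary.PropositionalEquality hiding ([_])
open import Relation.Nullary using (yes; no; ¬_)
open import Relation.Unary using (Pred; ∁; _∩_)

maxUpTo : ℕ → (ℕ → ℕ) → ℕ
maxUpTo zero    f = 0
maxUpTo (suc n) f = f 0 ⊔ maxUpTo n (f ∘ suc)

maxUpTo-cong : ∀ n {f g : ℕ → ℕ} → (∀ j → j < n → f j ≡ g j) → maxUpTo n f ≡ maxUpTo n g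
maxUpTo-cong zero    f≗g = refl
maxUpTo-cong (suc n) f≗g = cong₂ _⊔_ (f≗g 0 z<s) (maxUpTo-cong n (λ j j<n → f≗g (suc j) (s≤s j<n)))

maxUpTo-lub : ∀ n {f : ℕ → ℕ} {b} → (∀ j → j < n → f j ≤ b) → maxUpTo n f ≤ b
maxUpTo-lub zero    f≤b = z≤n
maxUpTo-lub (suc n) f≤b = ⊔-lub (f≤b 0 z<s) (maxUpTo-lub n (λ j j<n → f≤b (suc j) (s≤s j<n)))

maxUpTo-zero : ∀ n {f : ℕ → ℕ} → (∀ j → j < n → f j ≡ 0) → maxUpTo n f ≡ 0
maxUpTo-zero n f≡0 = n≤0⇒n≡0 (maxUpTo-lub n (λ j j<n → ≤-reflexive (f≡0 j j<n)))

maxUpTo-+ : ∀ m n (f : ℕ → ℕ) → maxUpTo (m + n) f ≡ maxUpTo m f ⊔ maxUpTo n (λ j → f (m + j))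
maxUpTo-+ zero    n f = refl
maxUpTo-+ (suc m) n f = trans (cong (f 0 ⊔_) (maxUpTo-+ m n (f ∘ suc))) (sym (⊔-assoc (f 0) _ _))

drop-++ˡ : ∀ {A : Set} i (x y : List A) → i ≤ length x → drop i (x ++ y) ≡ drop i x ++ y
drop-++ˡ zero    x       y _         = refl
drop-++ˡ (suc i) (a ∷ x) y (s≤s i≤x) = drop-++ˡ i x y i≤x

drop-++ʳ : ∀ {A : Set} (x y : List A) j → drop (length x + j) (x ++ y) ≡ drop j y
drop-++ʳ []      y j = refl
drop-++ʳ (a ∷ x) y j = drop-++ʳ x y j

length-drop-injective : ∀ {A : Set} (x : List A) {i j} → i ≤ length x → j ≤ length x →
                        length (drop i x) ≡ length (drop j x) → i ≡ j
length-drop-injective x {i} {j} i≤x j≤x eq =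
  ∸-cancelˡ-≡ i≤x j≤x (trans (sym (length-drop i x)) (trans eq (length-drop j x)))

module _ {σ : ℕ} where

  lexLt-< : ∀ {a c : Fin σ} x y → a Fin.< c → lexLt (a ∷ x) (c ∷ y) ≡ true
  lexLt-< {a} {c} x y a<c with a Fin.<? c
  ... | yes _   = refl
  ... | no a≮c = ⊥-elim (a≮c a<c)

  lexLt-> : ∀ {a c : Fin σ} x y → c Fin.< a → lexLt (a ∷ x) (c ∷ y) ≡ false
  lexLt-> {a} {c} x y c<a with a Fin.<? c
  ... | yes a<c = ⊥-elim (Finₚ.<-asym a<c c<a)
  ... | no _ with a Fin.≟ c
  ...   | yes refl = ⊥-elim (Finₚ.<-irrefl refl c<a)
  ...   | no _     = refl

  lexLt-∷ : ∀ (a : Fin σ) x y → lexLt (a ∷ x) (a ∷ y) ≡ lexLt x y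
  lexLt-∷ a x y with a Fin.<? a
  ... | yes a<a = ⊥-elim (Finₚ.<-irrefl refl a<a)
  ... | no _ with a Fin.≟ a
  ...   | yes _  = refl
  ...   | no a≢a = ⊥-elim (a≢a refl)

  lexLt-irrefl : ∀ (x : List (Fin σ)) → lexLt x x ≡ false
  lexLt-irrefl []      = refl
  lexLt-irrefl (a ∷ x) = trans (lexLt-∷ a x x) (lexLt-irrefl x)

  lexLt-[] : ∀ (x : List (Fin σ)) → lexLt x [] ≡ false
  lexLt-[] []      = refl
  lexLt-[] (_ ∷ _) = refl

  lexLt-∷-inv : ∀ {a c : Fin σ} x y → lexLt (a ∷ x) (c ∷ y) ≡ true →
                a Fin.< c ⊎ (a ≡ c × lexLt x y ≡ true)
  lexLt-∷-inv {a} {c} x y lt with Finₚ.<-cmp a c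
  ... | tri< a<c _ _    = inj₁ a<c
  ... | tri≈ _ refl _   = inj₂ (refl , trans (sym (lexLt-∷ a x y)) lt)
  ... | tri> _ _ c<a with () ← trans (sym lt) (lexLt-> x y c<a)

  lexLt-≮⇒≥ : ∀ (x y : List (Fin σ)) → lexLt x y ≡ false → y ≡ x ⊎ lexLt y x ≡ true
  lexLt-≮⇒≥ []      []      _  = inj₁ refl
  lexLt-≮⇒≥ (_ ∷ _) []      _  = inj₂ refl
  lexLt-≮⇒≥ (a ∷ x) (c ∷ y) ge with Finₚ.<-cmp a c
  ... | tri< a<c _ _ with () ← trans (sym (lexLt-< x y a<c)) ge
  ... | tri> _ _ c<a = inj₂ (lexLt-< y x c<a)
  ... | tri≈ _ refl _ with lexLt-≮⇒≥ x y (trans (sym (lexLt-∷ a x y)) ge)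
  ...   | inj₁ refl = inj₁ refl
  ...   | inj₂ y<x  = inj₂ (trans (lexLt-∷ a y x) y<x)

  lcp-∷ : ∀ (a : Fin σ) x y → lcp (a ∷ x) (a ∷ y) ≡ suc (lcp x y)
  lcp-∷ a x y with a Fin.≟ a
  ... | yes _  = refl
  ... | no a≢a = ⊥-elim (a≢a refl)

  lcp-≢ : ∀ {a c : Fin σ} x y → a ≢ c → lcp (a ∷ x) (c ∷ y) ≡ 0
  lcp-≢ {a} {c} x y a≢c with a Fin.≟ c
  ... | yes a≡c = ⊥-elim (a≢c a≡c)
  ... | no _    = refl

  lcp-≤-length : ∀ (x y : List (Fin σ)) → lcp x y ≤ length x
  lcp-≤-length []      _       = z≤n
  lcp-≤-length (a ∷ x) []      = z≤n
  lcp-≤-length (a ∷ x) (c ∷ y) with a Fin.≟ c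
  ... | yes _ = s≤s (lcp-≤-length x y)
  ... | no _  = z≤n

  lcp-≤-between : ∀ (b t s : List (Fin σ)) → lexLt b t ≡ true → lexLt t s ≡ true → lcp s b ≤ lcp s t
  lcp-≤-between []      _       []      _  _  = z≤n
  lcp-≤-between []      _       (_ ∷ _) _  _  = z≤n
  lcp-≤-between (_ ∷ _) []      _       () _
  lcp-≤-between (_ ∷ _) (_ ∷ _) []      _  ()
  lcp-≤-between (a ∷ b) (c ∷ t) (d ∷ s) b<t t<s with d Fin.≟ a
  ... | no _ = z≤n
  ... | yes refl with lexLt-∷-inv {a} {c} b t b<t | lexLt-∷-inv {c} {a} t s t<s
  ...   | inj₂ (refl , b<t′) | inj₂ (refl , t<s′) rewrite lcp-∷ a s t =
    s≤s (lcp-≤-between b t s b<t′ t<s′)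
  ...   | inj₁ a<c          | inj₁ c<a          = ⊥-elim (Finₚ.<-asym a<c c<a)
  ...   | inj₁ a<a          | inj₂ (refl , _)   = ⊥-elim (Finₚ.<-irrefl refl a<a)
  ...   | inj₂ (refl , _)   | inj₁ a<a          = ⊥-elim (Finₚ.<-irrefl refl a<a)

  lcpBelow : List (Fin σ) → List (Fin σ) → ℕ
  lcpBelow s t = if lexLt t s then lcp s t else 0

  -- When the first letters of y and y′ differ from c, SameSide y y′ c says that y and y′ lie on
  -- the same side of every string beginning with c (see lexLt-∁ˡ and lexLt-∁ʳ below).
  SameSide : List (Fin σ) → List (Fin σ) → Pred (Fin σ) 0ℓ
  SameSide y y′ c = lexLt y [ c ] ≡ lexLt y′ [ c ]

  SameSide-∷ : ∀ (b : Fin σ) r r′ c → SameSide (b ∷ r) (b ∷ r′) c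
  SameSide-∷ b r r′ c with b Fin.<? c
  ... | yes _ = refl
  ... | no _ with b Fin.≟ c
  ...   | yes refl = trans (lexLt-[] r) (sym (lexLt-[] r′))
  ...   | no _     = refl

  lcpBelow-self : ∀ (s : List (Fin σ)) → lcpBelow s s ≡ 0
  lcpBelow-self s rewrite lexLt-irrefl s = refl

  lcpBelow-≤-lcp : ∀ (s t : List (Fin σ)) → lcpBelow s t ≤ lcp s t
  lcpBelow-≤-lcp s t with lexLt t s
  ... | true  = ≤-refl
  ... | false = z≤n

  lcp≡0⇒lcpBelow≡0 : ∀ (s t : List (Fin σ)) → lcp s t ≡ 0 → lcpBelow s t ≡ 0
  lcp≡0⇒lcpBelow≡0 s t eq = n≤0⇒n≡0 (subst (lcpBelow s t ≤_) eq (lcpBelow-≤-lcp s t))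

  predIn-below : ∀ ts (s : List (Fin σ)) → Maybe.All (λ b → lexLt b s ≡ true) (predIn ts s)
  predIn-below []       s = Maybe.nothing
  predIn-below (t ∷ ts) s with predIn ts s | predIn-below ts s
  ... | nothing | _ with lexLt t s in t<s
  ...   | true  = Maybe.just t<s
  ...   | false = Maybe.nothing
  predIn-below (t ∷ ts) s | just b | b<s with lexLt t s in t<s
  ...   | false = b<s
  ...   | true with lexLt b t
  ...     | true  = Maybe.just t<s
  ...     | false = b<s

  -- The predecessor of s among the candidates is the one sharing the longest prefix with s.
  predIn-lcp-∷ : ∀ t ts (s : List (Fin σ)) →
                 maybe (lcp s) 0 (predIn (t ∷ ts) s) ≡ lcpBelow s t ⊔ maybe (lcp s) 0 (predIn ts s)
  predIn-lcp-∷ t ts s with predIn ts s | predIn-below ts s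
  ... | nothing | _ with lexLt t s
  ...   | true  = sym (⊔-identityʳ (lcp s t))
  ...   | false = refl
  predIn-lcp-∷ t ts s | just b | Maybe.just b<s with lexLt t s in t<s
  ...   | false = refl
  ...   | true with lexLt b t in b<t
  ...     | true  = sym (m≥n⇒m⊔n≡m (lcp-≤-between b t s b<t t<s))
  ...     | false with lexLt-≮⇒≥ b t b<t
  ...       | inj₁ refl = sym (⊔-idem (lcp s t))
  ...       | inj₂ t<b  = sym (m≤n⇒m⊔n≡n (lcp-≤-between t b s t<b b<s))

  predIn-lcp : ∀ n (F : ℕ → List (Fin σ)) s →
               maybe (lcp s) 0 (predIn (applyUpTo F n) s) ≡ maxUpTo n (λ j → lcpBelow s (F j))
  predIn-lcp zero    F s = refl
  predIn-lcp (suc n) F s =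
    trans (predIn-lcp-∷ (F 0) (applyUpTo (F ∘ suc) n) s)
          (cong (lcpBelow s (F 0) ⊔_) (predIn-lcp n (F ∘ suc) s))

  phraseLen-maxUpTo : ∀ (w : List (Fin σ)) i →
                      phraseLen w i ≡ 1 ⊔ maxUpTo (length w) (λ j → lcpBelow (drop i w) (drop j w))
  phraseLen-maxUpTo w i = cong (1 ⊔_) (begin
    maybe (lcp s) 0 (predIn (map (λ j → drop j w) (upTo (length w))) s)
      ≡⟨ cong (λ ts → maybe (lcp s) 0 (predIn ts s)) (map-upTo (λ j → drop j w) (length w)) ⟩
    maybe (lcp s) 0 (predIn (applyUpTo (λ j → drop j w) (length w)) s)
      ≡⟨ predIn-lcp (length w) (λ j → drop j w) s ⟩
    maxUpTo (length w) (λ j → lcpBelow s (drop j w)) ∎)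
    where
    open ≡-Reasoning
    s = drop i w

  phraseLen-≥1 : ∀ (w : List (Fin σ)) i → 1 ≤ phraseLen w i
  phraseLen-≥1 w i = m≤m⊔n 1 (maybe (lcp (drop i w)) 0 (predSuffix w (drop i w)))

  phraseLen-++ : ∀ (x y : List (Fin σ)) i → let s = drop i (x ++ y) in
    phraseLen (x ++ y) i ≡ 1 ⊔ (maxUpTo (length x) (λ j → lcpBelow s (drop j x ++ y))
                              ⊔ maxUpTo (length y) (λ j → lcpBelow s (drop j y)))
  phraseLen-++ x y i = begin
    phraseLen (x ++ y) i
      ≡⟨ phraseLen-maxUpTo (x ++ y) i ⟩
    1 ⊔ maxUpTo (length (x ++ y)) F
      ≡⟨ cong (λ n → 1 ⊔ maxUpTo n F) (length-++ x) ⟩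
    1 ⊔ maxUpTo (length x + length y) F
      ≡⟨ cong (1 ⊔_) (maxUpTo-+ (length x) (length y) F) ⟩
    1 ⊔ (maxUpTo (length x) F ⊔ maxUpTo (length y) (λ j → F (length x + j)))
      ≡⟨ cong₂ (λ m n → 1 ⊔ (m ⊔ n)) fromX fromY ⟩
    1 ⊔ (maxUpTo (length x) (λ j → lcpBelow s (drop j x ++ y))
         ⊔ maxUpTo (length y) (λ j → lcpBelow s (drop j y)))                        ∎
    where
    open ≡-Reasoning
    s = drop i (x ++ y)
    F = λ j → lcpBelow s (drop j (x ++ y))
    fromX : maxUpTo (length x) F ≡ maxUpTo (length x) (λ j → lcpBelow s (drop j x ++ y))
    fromX = maxUpTo-cong (length x) λ j j<x → cong (lcpBelow s) (drop-++ˡ j x y (<⇒≤ j<x))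
    fromY : maxUpTo (length y) (λ j → F (length x + j))
          ≡ maxUpTo (length y) (λ j → lcpBelow s (drop j y))
    fromY = maxUpTo-cong (length y) λ j _ → cong (lcpBelow s) (drop-++ʳ x y j)

data Parse (g : ℕ → ℕ) (L : ℕ) : ℕ → ℕ → Set where
  done : ∀ {i}   → L ≤ i → Parse g L i 0
  step : ∀ {i n} → i < L → Parse g L (i + g i) n → Parse g L i (suc n)

Parse-unique : ∀ {g L i m n} → Parse g L i m → Parse g L i n → m ≡ n
Parse-unique (done _)   (done _)   = refl
Parse-unique (done L≤i) (step i<L _) = ⊥-elim (≤⇒≯ L≤i i<L)
Parse-unique (step i<L _) (done L≤i) = ⊥-elim (≤⇒≯ L≤i i<L)
Parse-unique (step _ p) (step _ q) = cong suc (Parse-unique p q)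

Parse-cong : ∀ {g h L i n} → (∀ j → j < L → g j ≡ h j) → Parse g L i n → Parse h L i n
Parse-cong g≗h (done L≤i) = done L≤i
Parse-cong {h = h} {L} {i} g≗h (step {n = n} i<L p) =
  step i<L (subst (λ k → Parse h L (i + k) n) (g≗h i i<L) (Parse-cong g≗h p))

Parse-shift : ∀ {g h L i n} X → (∀ j → j < L → h (X + j) ≡ g j) → Parse g L i n → Parse h (X + L) (X + i) n
Parse-shift X h≗g (done L≤i) = done (+-monoʳ-≤ X L≤i)
Parse-shift {g} {h} {L} {i} X h≗g (step {n = n} i<L p) =
  step (+-monoʳ-< X i<L) (subst (λ k → Parse h (X + L) k n) shifted (Parse-shift X h≗g p))
  where
  shifted : X + (i + g i) ≡ X + i + h (X + i)
  shifted = trans (sym (+-assoc X i (g i))) (cong (X + i +_) (sym (h≗g i i<L)))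

Parse-++ : ∀ {g X L i m n} → (∀ j → j < X → j + g j ≤ X) → i ≤ X → X ≤ L →
           Parse g X i m → Parse g L X n → Parse g L i (m + n)
Parse-++ {g} {L = L} {n = n} lands i≤X X≤L (done X≤i) q = subst (λ k → Parse g L k n) (≤-antisym X≤i i≤X) q
Parse-++ lands i≤X X≤L (step i<X p) q = step (<-≤-trans i<X X≤L) (Parse-++ lands (lands _ i<X) X≤L p q)

private
  ∸-step : ∀ {L i k} f → i < L → 1 ≤ k → L ∸ i ≤ suc f → L ∸ (i + k) ≤ f
  ∸-step {L} {i} {k} f i<L 1≤k L∸i≤1+f = ≤-trans (∸-monoʳ-≤ L (m<m+n i 1≤k))
    (≤-pred (subst (_≤ suc f) (+-∸-assoc 1 i<L) L∸i≤1+f))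

Parse-exists : ∀ {g L} → (∀ j → 1 ≤ g j) → ∀ f i → L ∸ i ≤ f → ∃[ n ] Parse g L i n
Parse-exists g≥1 zero    i L∸i≤0 = 0 , done (m∸n≡0⇒m≤n (n≤0⇒n≡0 L∸i≤0))
Parse-exists {g} {L} g≥1 (suc f) i L∸i≤f with i <? L
... | no i≮L  = 0 , done (≮⇒≥ i≮L)
... | yes i<L with Parse-exists g≥1 f (i + g i) (∸-step f i<L (g≥1 i) L∸i≤f)
...   | n , p = suc n , step i<L p

module _ {σ : ℕ} where

  parseFrom-Parse : ∀ (w : List (Fin σ)) f i → length w ∸ i ≤ f →
                    Parse (phraseLen w) (length w) i (length (parseFrom f w i))
  parseFrom-Parse w zero    i L∸i≤0 = done (m∸n≡0⇒m≤n (n≤0⇒n≡0 L∸i≤0))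
  parseFrom-Parse w (suc f) i L∸i≤f with i <ᵇ length w in i<ᵇL
  ... | true  = step i<L (parseFrom-Parse w f (i + phraseLen w i) (∸-step f i<L (phraseLen-≥1 w i) L∸i≤f))
    where i<L = <ᵇ⇒< i (length w) (subst T (sym i<ᵇL) tt)
  ... | false = done (≮⇒≥ (λ i<L → subst T i<ᵇL (<⇒<ᵇ i<L)))

  v-Parse : ∀ (w : List (Fin σ)) → Parse (phraseLen w) (length w) 0 (v w)
  v-Parse w = parseFrom-Parse w (length w) 0 ≤-refl

  v-[_] : ∀ (a : Fin σ) → v [ a ] ≡ 1
  v-[ a ] = Parse-unique (v-Parse [ a ]) (step z<s (done (phraseLen-≥1 [ a ] 0)))

-- Words over two separated alphabets

module _ {σ : ℕ} {P : Pred (Fin σ) 0ℓ} where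

  lcp-∁ˡ : ∀ (s r t : List (Fin σ)) → All P s → 0 < length s → All (∁ P) t → lcp (s ++ r) t ≡ 0
  lcp-∁ˡ (c ∷ s) r []      _        _ _          = refl
  lcp-∁ˡ (c ∷ s) r (b ∷ t) (pc ∷ _) _ (¬pb ∷ _) = lcp-≢ (s ++ r) t λ { refl → ¬pb pc }

  lcp-∁ʳ : ∀ (s r t : List (Fin σ)) → All P s → 0 < length s → All (∁ P) t → lcp t (s ++ r) ≡ 0
  lcp-∁ʳ (c ∷ s) r []      _        _ _          = refl
  lcp-∁ʳ (c ∷ s) r (b ∷ t) (pc ∷ _) _ (¬pb ∷ _) = lcp-≢ t (s ++ r) λ { refl → ¬pb pc }

  lexLt-∁ˡ : ∀ {c : Fin σ} r y → P c → All (∁ P) y → lexLt y (c ∷ r) ≡ lexLt y [ c ]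
  lexLt-∁ˡ r []          _  _         = refl
  lexLt-∁ˡ {c} r (b ∷ y) pc (¬pb ∷ _) with Finₚ.<-cmp b c
  ... | tri< b<c _ _  = trans (lexLt-< y r b<c) (sym (lexLt-< y [] b<c))
  ... | tri≈ _ refl _ = ⊥-elim (¬pb pc)
  ... | tri> _ _ c<b  = trans (lexLt-> y r c<b) (sym (lexLt-> y [] c<b))

  lexLt-∁ʳ : ∀ {c : Fin σ} r y → P c → All (∁ P) y → lexLt (c ∷ r) y ≡ not (lexLt y [ c ])
  lexLt-∁ʳ r []          _  _         = refl
  lexLt-∁ʳ {c} r (b ∷ y) pc (¬pb ∷ _) with Finₚ.<-cmp b c
  ... | tri< b<c _ _  = trans (lexLt-> r y b<c) (cong not (sym (lexLt-< y [] b<c)))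
  ... | tri≈ _ refl _ = ⊥-elim (¬pb pc)
  ... | tri> _ _ c<b  = trans (lexLt-< r y c<b) (cong not (sym (lexLt-> y [] c<b)))

  lcp-++-∁ : ∀ (x₁ x₂ y : List (Fin σ)) → All P x₁ → All P x₂ → length x₁ ≢ length x₂ → All (∁ P) y →
             lcp (x₁ ++ y) (x₂ ++ y) ≡ lcp x₁ x₂
  lcp-++-∁ []       []       y _         _         x₁≢x₂ _  = ⊥-elim (x₁≢x₂ refl)
  lcp-++-∁ []       (c ∷ x₂) y _         px₂       _     py = lcp-∁ʳ (c ∷ x₂) y y px₂ z<s py
  lcp-++-∁ (a ∷ x₁) []       y px₁       _         _     py = lcp-∁ˡ (a ∷ x₁) y y px₁ z<s py
  lcp-++-∁ (a ∷ x₁) (c ∷ x₂) y (_ ∷ px₁) (_ ∷ px₂) x₁≢x₂ py with a Fin.≟ c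
  ... | yes refl = cong suc (lcp-++-∁ x₁ x₂ y px₁ px₂ (x₁≢x₂ ∘ cong suc) py)
  ... | no _     = refl

  lexLt-++-∁ : ∀ (x₁ x₂ : List (Fin σ)) {y y′} → All (P ∩ SameSide y y′) x₁ → All (P ∩ SameSide y y′) x₂ →
               All (∁ P) y → All (∁ P) y′ → lexLt (x₁ ++ y) (x₂ ++ y) ≡ lexLt (x₁ ++ y′) (x₂ ++ y′)
  lexLt-++-∁ []       []       {y} {y′} _ _ _ _ = trans (lexLt-irrefl y) (sym (lexLt-irrefl y′))
  lexLt-++-∁ []       (c ∷ x₂) {y} {y′} _ ((pc , same) ∷ _) py py′ =
    trans (lexLt-∁ˡ (x₂ ++ y) y pc py) (trans same (sym (lexLt-∁ˡ (x₂ ++ y′) y′ pc py′)))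
  lexLt-++-∁ (a ∷ x₁) []       {y} {y′} ((pa , same) ∷ _) _ py py′ =
    trans (lexLt-∁ʳ (x₁ ++ y) y pa py) (trans (cong not same) (sym (lexLt-∁ʳ (x₁ ++ y′) y′ pa py′)))
  lexLt-++-∁ (a ∷ x₁) (c ∷ x₂) (_ ∷ q₁) (_ ∷ q₂) py py′ with a Fin.<? c
  ... | yes _ = refl
  ... | no _ with a Fin.≟ c
  ...   | yes refl = lexLt-++-∁ x₁ x₂ q₁ q₂ py py′
  ...   | no _     = refl

module Concat {σ : ℕ} {P : Pred (Fin σ) 0ℓ} (x y : List (Fin σ)) (px : All P x) (py : All (∁ P) y) where

  private
    X = length x
    Y = length y

    0<length-drop : ∀ {i} → i < X → 0 < length (drop i x)
    0<length-drop {i} i<X = subst (0 <_) (sym (length-drop i x)) (m<n⇒0<n∸m i<X)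

    length-drop-≢ : ∀ {i j} → i < X → j < X → i ≢ j → length (drop i x) ≢ length (drop j x)
    length-drop-≢ i<X j<X i≢j = i≢j ∘ length-drop-injective x (<⇒≤ i<X) (<⇒≤ j<X)

  maxBelowˣ maxBelowʸ : List (Fin σ) → ℕ
  maxBelowˣ s = maxUpTo X (λ j → lcpBelow s (drop j x ++ y))
  maxBelowʸ s = maxUpTo Y (λ j → lcpBelow s (drop j y))

  phraseLen-x : ∀ i → i < X → phraseLen (x ++ y) i ≡ 1 ⊔ maxBelowˣ (drop i x ++ y)
  phraseLen-x i i<X = begin
    phraseLen (x ++ y) i                  ≡⟨ phraseLen-++ x y i ⟩
    1 ⊔ (maxBelowˣ s′ ⊔ maxBelowʸ s′)     ≡⟨ cong (λ t → 1 ⊔ (maxBelowˣ t ⊔ maxBelowʸ t))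
                                                   (drop-++ˡ i x y (<⇒≤ i<X)) ⟩
    1 ⊔ (maxBelowˣ s ⊔ maxBelowʸ s)       ≡⟨ cong (λ m → 1 ⊔ (maxBelowˣ s ⊔ m)) (maxUpTo-zero Y crossing) ⟩
    1 ⊔ (maxBelowˣ s ⊔ 0)                 ≡⟨ cong (1 ⊔_) (⊔-identityʳ (maxBelowˣ s)) ⟩
    1 ⊔ maxBelowˣ s                       ∎
    where
    open ≡-Reasoning
    s′ = drop i (x ++ y)
    s  = drop i x ++ y
    crossing : ∀ j → j < Y → lcpBelow s (drop j y) ≡ 0
    crossing j _ = lcp≡0⇒lcpBelow≡0 s (drop j y)
      (lcp-∁ˡ (drop i x) y (drop j y) (drop⁺ i px) (0<length-drop i<X) (drop⁺ j py))

  phraseLen-y : ∀ j → phraseLen (x ++ y) (X + j) ≡ phraseLen y j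
  phraseLen-y j = begin
    phraseLen (x ++ y) (X + j)            ≡⟨ phraseLen-++ x y (X + j) ⟩
    1 ⊔ (maxBelowˣ s′ ⊔ maxBelowʸ s′)     ≡⟨ cong (λ t → 1 ⊔ (maxBelowˣ t ⊔ maxBelowʸ t))
                                                   (drop-++ʳ x y j) ⟩
    1 ⊔ (maxBelowˣ s ⊔ maxBelowʸ s)       ≡⟨ cong (λ m → 1 ⊔ (m ⊔ maxBelowʸ s)) (maxUpTo-zero X crossing) ⟩
    1 ⊔ maxBelowʸ s                       ≡⟨ phraseLen-maxUpTo y j ⟨
    phraseLen y j                         ∎
    where
    open ≡-Reasoning
    s′ = drop (X + j) (x ++ y)
    s  = drop j y
    crossing : ∀ k → k < X → lcpBelow s (drop k x ++ y) ≡ 0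
    crossing k k<X = lcp≡0⇒lcpBelow≡0 s (drop k x ++ y)
      (lcp-∁ʳ (drop k x) y s (drop⁺ k px) (0<length-drop k<X) (drop⁺ j py))

  -- Two distinct suffixes of x ++ y starting in x already differ inside x (lcp-++-∁).
  phraseLen-x-≤ : ∀ i → i < X → i + phraseLen (x ++ y) i ≤ X
  phraseLen-x-≤ i i<X = ≤-trans (+-monoʳ-≤ i phrase≤rest) (≤-reflexive (m+[n∸m]≡n (<⇒≤ i<X)))
    where
    s = drop i x ++ y
    lcpBelow≤rest : ∀ j → j < X → lcpBelow s (drop j x ++ y) ≤ X ∸ i
    lcpBelow≤rest j j<X with i ≟ j
    ... | yes refl = ≤-trans (≤-reflexive (lcpBelow-self s)) z≤n
    ... | no i≢j   = begin
      lcpBelow s (drop j x ++ y) ≤⟨ lcpBelow-≤-lcp s (drop j x ++ y) ⟩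
      lcp s (drop j x ++ y)      ≡⟨ lcp-++-∁ (drop i x) (drop j x) y (drop⁺ i px) (drop⁺ j px)
                                               (length-drop-≢ i<X j<X i≢j) py ⟩
      lcp (drop i x) (drop j x)  ≤⟨ lcp-≤-length (drop i x) (drop j x) ⟩
      length (drop i x)          ≡⟨ length-drop i x ⟩
      X ∸ i                      ∎
      where open ≤-Reasoning
    phrase≤rest : phraseLen (x ++ y) i ≤ X ∸ i
    phrase≤rest = subst (_≤ X ∸ i) (sym (phraseLen-x i i<X))
                        (⊔-lub (m<n⇒0<n∸m i<X) (maxUpTo-lub X lcpBelow≤rest))

  v-++-prefix : ∀ {m} → Parse (phraseLen (x ++ y)) X 0 m → v (x ++ y) ≡ m + v y
  v-++-prefix prefix = Parse-unique whole (Parse-++ phraseLen-x-≤ z≤n (m≤m+n X Y) prefix suffix)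
    where
    whole : Parse (phraseLen (x ++ y)) (X + Y) 0 (v (x ++ y))
    whole = subst (λ L → Parse (phraseLen (x ++ y)) L 0 (v (x ++ y))) (length-++ x) (v-Parse (x ++ y))
    suffix : Parse (phraseLen (x ++ y)) (X + Y) X (v y)
    suffix = subst (λ i → Parse (phraseLen (x ++ y)) (X + Y) i (v y)) (+-identityʳ X)
                   (Parse-shift X (λ j _ → phraseLen-y j) (v-Parse y))

module _ {σ : ℕ} {P : Pred (Fin σ) 0ℓ} (x y y′ : List (Fin σ))
         (qx : All (P ∩ SameSide y y′) x) (py : All (∁ P) y) (py′ : All (∁ P) y′) where

  private
    px : All P x
    px = All.map proj₁ qx

  phraseLen-++-cong : ∀ i → i < length x → phraseLen (x ++ y) i ≡ phraseLen (x ++ y′) i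
  phraseLen-++-cong i i<X = begin
    phraseLen (x ++ y) i                      ≡⟨ Concat.phraseLen-x x y px py i i<X ⟩
    1 ⊔ Concat.maxBelowˣ x y px py s          ≡⟨ cong (1 ⊔_) (maxUpTo-cong (length x) agree) ⟩
    1 ⊔ Concat.maxBelowˣ x y′ px py′ s′       ≡⟨ Concat.phraseLen-x x y′ px py′ i i<X ⟨
    phraseLen (x ++ y′) i                     ∎
    where
    open ≡-Reasoning
    s  = drop i x ++ y
    s′ = drop i x ++ y′
    agree : ∀ j → j < length x → lcpBelow s (drop j x ++ y) ≡ lcpBelow s′ (drop j x ++ y′)
    agree j j<X with i ≟ j
    ... | yes refl = trans (lcpBelow-self s) (sym (lcpBelow-self s′))
    ... | no i≢j   = cong₂ (λ b l → if b then l else 0)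
      (lexLt-++-∁ (drop j x) (drop i x) (drop⁺ j qx) (drop⁺ i qx) py py′)
      (trans (lcp-++-∁ (drop i x) (drop j x) y  (drop⁺ i px) (drop⁺ j px) x≢ py)
        (sym (lcp-++-∁ (drop i x) (drop j x) y′ (drop⁺ i px) (drop⁺ j px) x≢ py′)))
      where
      x≢ : length (drop i x) ≢ length (drop j x)
      x≢ = i≢j ∘ length-drop-injective x (<⇒≤ i<X) (<⇒≤ j<X)

  v-++ : v (x ++ y) + v y′ ≡ v (x ++ y′) + v y
  v-++ = begin
    v (x ++ y) + v y′   ≡⟨ cong (_+ v y′) (Concat.v-++-prefix x y px py prefix) ⟩
    m + v y + v y′      ≡⟨ xy∙z≈xz∙y m (v y) (v y′) ⟩
    m + v y′ + v y      ≡⟨ cong (_+ v y) (Concat.v-++-prefix x y′ px py′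
                                               (Parse-cong phraseLen-++-cong prefix)) ⟨
    v (x ++ y′) + v y   ∎
    where
    open ≡-Reasoning
    prefixParse : ∃[ m ] Parse (phraseLen (x ++ y)) (length x) 0 m
    prefixParse = Parse-exists (phraseLen-≥1 (x ++ y)) (length x) 0 ≤-refl
    m      = proj₁ prefixParse
    prefix = proj₂ prefixParse

v-++-additive : ∀ {σ} {P : Pred (Fin σ) 0ℓ} (x y : List (Fin σ)) →
                All (P ∩ SameSide y []) x → All (∁ P) y → v (x ++ y) ≡ v x + v y
v-++-additive {σ} x y qx py = begin
  v (x ++ y)              ≡⟨ +-identityʳ (v (x ++ y)) ⟨
  v (x ++ y) + v {σ} []   ≡⟨ v-++ x y [] qx py [] ⟩
  v (x ++ []) + v y       ≡⟨ cong (λ w → v w + v y) (++-identityʳ x) ⟩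
  v x + v y               ∎
  where open ≡-Reasoning

-- Order-preserving renaming of the alphabet

module _ {σ τ : ℕ} (f : Fin σ → Fin τ) (f-mono : ∀ {a b} → a Fin.< b → f a Fin.< f b) where

  private
    f-≢ : ∀ {a b} → a ≢ b → f a ≢ f b
    f-≢ {a} {b} a≢b with Finₚ.<-cmp a b
    ... | tri< a<b _ _  = Finₚ.<⇒≢ (f-mono a<b)
    ... | tri≈ _ a≡b _  = ⊥-elim (a≢b a≡b)
    ... | tri> _ _ b<a  = Finₚ.<⇒≢ (f-mono b<a) ∘ sym

  lexLt-map : ∀ (x y : List (Fin σ)) → lexLt (map f x) (map f y) ≡ lexLt x y
  lexLt-map []      []      = refl
  lexLt-map []      (_ ∷ _) = refl
  lexLt-map (_ ∷ _) []      = refl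
  lexLt-map (a ∷ x) (c ∷ y) with Finₚ.<-cmp a c
  ... | tri< a<c _ _  = trans (lexLt-< (map f x) (map f y) (f-mono a<c)) (sym (lexLt-< x y a<c))
  ... | tri≈ _ refl _ =
    trans (lexLt-∷ (f a) (map f x) (map f y)) (trans (lexLt-map x y) (sym (lexLt-∷ a x y)))
  ... | tri> _ _ c<a  = trans (lexLt-> (map f x) (map f y) (f-mono c<a)) (sym (lexLt-> x y c<a))

  lcp-map : ∀ (x y : List (Fin σ)) → lcp (map f x) (map f y) ≡ lcp x y
  lcp-map []      []      = refl
  lcp-map []      (_ ∷ _) = refl
  lcp-map (_ ∷ _) []      = refl
  lcp-map (a ∷ x) (c ∷ y) with a Fin.≟ c
  ... | yes refl = trans (lcp-∷ (f a) (map f x) (map f y)) (cong suc (lcp-map x y))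
  ... | no a≢c   = lcp-≢ (map f x) (map f y) (f-≢ a≢c)

  lcpBelow-map : ∀ (s t : List (Fin σ)) → lcpBelow (map f s) (map f t) ≡ lcpBelow s t
  lcpBelow-map s t = cong₂ (λ b l → if b then l else 0) (lexLt-map t s) (lcp-map s t)

  phraseLen-map : ∀ (w : List (Fin σ)) i → phraseLen (map f w) i ≡ phraseLen w i
  phraseLen-map w i = begin
    phraseLen (map f w) i                            ≡⟨ phraseLen-maxUpTo (map f w) i ⟩
    1 ⊔ maxUpTo (length (map f w)) (lcpsAt (map f w)) ≡⟨ cong (λ n → 1 ⊔ maxUpTo n (lcpsAt (map f w))) (length-map f w) ⟩
    1 ⊔ maxUpTo (length w) (lcpsAt (map f w))        ≡⟨ cong (1 ⊔_) (maxUpTo-cong (length w) λ j _ → lcpsAt-map j) ⟩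
    1 ⊔ maxUpTo (length w) (lcpsAt w)                ≡⟨ phraseLen-maxUpTo w i ⟨
    phraseLen w i                                    ∎
    where
    open ≡-Reasoning
    lcpsAt : ∀ {ρ} → List (Fin ρ) → ℕ → ℕ
    lcpsAt u j = lcpBelow (drop i u) (drop j u)
    lcpsAt-map : ∀ j → lcpsAt (map f w) j ≡ lcpsAt w j
    lcpsAt-map j = trans (cong₂ lcpBelow (drop-map i w) (drop-map j w)) (lcpBelow-map (drop i w) (drop j w))

  v-map : ∀ (w : List (Fin σ)) → v (map f w) ≡ v w
  v-map w = Parse-unique
    (Parse-cong (λ j _ → phraseLen-map w j)
      (subst (λ L → Parse (phraseLen (map f w)) L 0 (v (map f w))) (length-map f w) (v-Parse (map f w))))
    (v-Parse w)

Low : ∀ {n} → Pred (Fin n) 0ℓ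
Low a = toℕ a < 3

↑ʳ-mono : ∀ {n} {a b : Fin n} → a Fin.< b → 3 ↑ʳ a Fin.< 3 ↑ʳ b
↑ʳ-mono = +-monoʳ-< 3

¬Low-↑ʳ : ∀ {n} (a : Fin n) → ¬ Low (3 ↑ʳ a)
¬Low-↑ʳ a = m+n≮m 3 (toℕ a)

block : ∀ {n} → List (Fin (3 + n))
block = zero ∷ zero ∷ suc zero ∷ zero ∷ zero ∷ zero ∷ []

word : ∀ k → List (Fin (suc (k * 3)))
word zero    = zero ∷ zero ∷ zero ∷ zero ∷ []
word (suc k) = block ++ map (3 ↑ʳ_) (word k)

word-∷ : ∀ k → word k ≡ zero ∷ drop 1 (word k)
word-∷ zero    = refl
word-∷ (suc k) = refl

length-word : ∀ k → length (word k) ≡ 4 + k * 6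
length-word zero    = refl
length-word (suc k) = cong (6 +_) (trans (length-map (3 ↑ʳ_) (word k)) (length-word k))

Low-block : ∀ {n} → All Low (block {n})
Low-block = z<s ∷ z<s ∷ s<s z<s ∷ z<s ∷ z<s ∷ z<s ∷ []

Low-reverse-block : ∀ {n} → All Low (reverse (block {n}))
Low-reverse-block = z<s ∷ z<s ∷ z<s ∷ s<s z<s ∷ z<s ∷ z<s ∷ []

module _ {n : ℕ} (r : List (Fin (suc n))) where
  open ≡-Reasoning

  private
    v-block-zero : v (block ++ [ 3 ↑ʳ zero {n} ]) ≡ 5
    v-block-zero = refl

  v-block-++-+1 : v (block ++ map (3 ↑ʳ_) (zero ∷ r)) + 1 ≡ 4 + v (zero ∷ r) + 1
  v-block-++-+1 = begin
    v (block ++ map (3 ↑ʳ_) (zero ∷ r)) + 1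
      ≡⟨ cong (v (block ++ map (3 ↑ʳ_) (zero ∷ r)) +_) v-[ 3 ↑ʳ zero {n} ] ⟨
    v (block ++ map (3 ↑ʳ_) (zero ∷ r)) + v [ 3 ↑ʳ zero {n} ]
      ≡⟨ v-++ block (map (3 ↑ʳ_) (zero ∷ r)) [ 3 ↑ʳ zero {n} ]
              (All.zip (Low-block , All.universal (SameSide-∷ (3 ↑ʳ zero {n}) (map (3 ↑ʳ_) r) []) block))
              (map⁺ (All.universal ¬Low-↑ʳ (zero ∷ r))) (¬Low-↑ʳ (zero {n}) ∷ []) ⟩
    v (block ++ [ 3 ↑ʳ zero {n} ]) + v (map (3 ↑ʳ_) (zero ∷ r))
      ≡⟨ cong₂ _+_ v-block-zero (v-map (3 ↑ʳ_) ↑ʳ-mono (zero ∷ r)) ⟩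
    5 + v (zero ∷ r)
      ≡⟨ +-comm 1 (4 + v (zero ∷ r)) ⟩
    4 + v (zero ∷ r) + 1 ∎

v-block-++ : ∀ {n r} (u : List (Fin (suc n))) → u ≡ zero ∷ r → v (block ++ map (3 ↑ʳ_) u) ≡ 4 + v u
v-block-++ {r = r} _ refl = +-cancelʳ-≡ 1 _ _ (v-block-++-+1 r)

reverse-block-++ : ∀ {n} (u : List (Fin (suc n))) →
                   reverse (block ++ map (3 ↑ʳ_) u) ≡ map (3 ↑ʳ_) (reverse u) ++ reverse block
reverse-block-++ u = begin
  reverse (block ++ map (3 ↑ʳ_) u)         ≡⟨ reverse-++ block (map (3 ↑ʳ_) u) ⟩
  reverse (map (3 ↑ʳ_) u) ++ reverse block ≡⟨ cong (_++ reverse block) (reverse-map (3 ↑ʳ_) u) ⟨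
  map (3 ↑ʳ_) (reverse u) ++ reverse block ∎
  where open ≡-Reasoning

v-reverse-block-++ : ∀ {n} (u : List (Fin (suc n))) → v (reverse (block ++ map (3 ↑ʳ_) u)) ≡ 5 + v (reverse u)
v-reverse-block-++ {n} u = begin
  v (reverse (block ++ map (3 ↑ʳ_) u))
    ≡⟨ cong v (reverse-block-++ u) ⟩
  v (map (3 ↑ʳ_) (reverse u) ++ reverse block)
    ≡⟨ v-++-additive {P = ∁ Low} (map (3 ↑ʳ_) (reverse u)) (reverse block)
         (map⁺ (All.universal (λ a → ¬Low-↑ʳ a , refl) (reverse u)))
         (All.map (λ low ¬low → ¬low low) Low-reverse-block) ⟩
  v (map (3 ↑ʳ_) (reverse u)) + v (reverse (block {suc n}))
    ≡⟨ cong₂ _+_ (v-map (3 ↑ʳ_) ↑ʳ-mono (reverse u)) v-reverse-block ⟩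
  v (reverse u) + 5
    ≡⟨ +-comm (v (reverse u)) 5 ⟩
  5 + v (reverse u) ∎
  where
  open ≡-Reasoning
  v-reverse-block : v (reverse (block {suc n})) ≡ 5
  v-reverse-block = refl

-- The step is stated for the unfolded word block ++ …: checking that v (word (suc k)) and
-- v (block ++ …) agree definitionally makes Agda evaluate v on a word with a symbolic tail,
-- which takes minutes.
word-elim : (P : ∀ k {σ} → List (Fin σ) → Set) → P 0 (word 0) →
            (∀ k → P k (word k) → P (suc k) (block ++ map (3 ↑ʳ_) (word k))) → ∀ k → P k (word k)
word-elim P base next zero    = base
word-elim P base next (suc k) = next k (word-elim P base next k)

v-word : ∀ k → v (word k) ≡ 2 + k * 4
v-word = word-elim (λ k w → v w ≡ 2 + k * 4) refl
  (λ k ih → trans (v-block-++ (word k) (word-∷ k)) (cong (4 +_) ih))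

v-reverse-word : ∀ k → v (reverse (word k)) ≡ 2 + k * 5
v-reverse-word = word-elim (λ k w → v (reverse w) ≡ 2 + k * 5) refl
  (λ k ih → trans (v-reverse-block-++ (word k)) (cong (5 +_) ih))

proposition5p9 : ∀ (N : ℕ) → ∃[ σ ] Σ (List (Fin σ)) λ w →
    N ≤ length w × 6 * v (reverse w) + 6 ≡ 6 * v w + (length w + 2)
proposition5p9 N = suc (N * 3) , word N , N≤length , balance
  where
  open ≡-Reasoning
  N≤length : N ≤ length (word N)
  N≤length = subst (N ≤_) (sym (length-word N)) (≤-trans (m≤m*n N 6) (m≤n+m (N * 6) 4))
  arithmetic : ∀ n → 6 * (2 + n * 5) + 6 ≡ 6 * (2 + n * 4) + (4 + n * 6 + 2)
  arithmetic = solve-∀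
  balance : 6 * v (reverse (word N)) + 6 ≡ 6 * v (word N) + (length (word N) + 2)
  balance = begin
    6 * v (reverse (word N)) + 6           ≡⟨ cong (λ r → 6 * r + 6) (v-reverse-word N) ⟩
    6 * (2 + N * 5) + 6                    ≡⟨ arithmetic N ⟩
    6 * (2 + N * 4) + (4 + N * 6 + 2)      ≡⟨ cong₂ (λ a n → 6 * a + (n + 2)) (v-word N) (length-word N) ⟨
    6 * v (word N) + (length (word N) + 2) ∎
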